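{- Let $m\in\{1,2,3,4',4'',5,6\}$ and $x=h/k\in S_{m1}$ with $\gcd(h,k)=1$, $k\ge1$. Put $\omega=e(x/2)$ and $z=e\big(u^{(m1)}_x/2\big)$. Then $(-\omega;\omega)_n=0$ for all $n\ge k$, and $(z;\omega)_{n+1}(z^{ -1}\omega;\omega)_{n+1}\neq0$ for all $0\le n\le k-1$. Consequently the series $g_2(z;\omega)=\sum_{n\ge0}\frac{(-\omega;\omega)_n\,\omega^{n(n+1)/2}}{(z;\omega)_{n+1}(z^{ -1}\omega;\omega)_{n+1}}$ (i.e. $g_2(e(u^{(m1)}_\tau/2);q^{1/2})$ at $\tau=x$) terminates and is a well-defined finite sum.
   Context: $e(u)=e^{2\pi iu}$, $(a;q)_n=\prod_{j=0}^{n-1}(1-aq^j)$, $\omega^{n(n+1)/2}:=e(xn(n+1)/4)$. $u^{(11)}_\tau=\frac\tau4+\frac12$, $u^{(21)}_\tau=\frac\tau4$, $u^{(31)}_\tau=\frac\tau3+\frac12$, $u^{(4'1)}_\tau=\frac\tau{12}$, $u^{(4''1)}_\tau=\frac{5\tau}{12}$, $u^{(51)}_\tau=\frac\tau6+\frac12$, $u^{(61)}_\tau=\frac\tau3$, and $u^{(m1)}_x$ is its value at $\tau=x$. Sets: $S:=\{h/k:h\in\mathbb Z,k\in\mathbb N,\gcd(h,k)=1,h\text{ odd}\}$, $S':=\{h/k\in S:h\equiv\pm1\pmod6\}$, $S_{ev}:=\{h/k\in S:k\text{ even}\}$; $S_{11}=S_{21}=S_{4'1}=S_{4''1}=S$,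 $S_{31}=S_{61}=S'$, $S_{51}=S'\cup S_{ev}$. -}

module Defs where

open import Level using (Level; _⊔_) renaming (suc to lsuc)
open import Algebra.Bundles using (CommutativeRing)
open import Data.Nat using (ℕ; zero; suc; NonZero)
open import Data.Integer as ℤ using (ℤ; +_; ∣_∣)
open import Data.Integer.Divisibility as ℤD using ()
open import Data.Nat.Divisibility as ℕD using ()
open import Data.Nat.Coprimality using (Coprime)
open import Data.Rational as ℚ using (ℚ)
open import Data.Product using (∃; _×_)
open import Data.Sum using (_⊎_)
open import Relation.Nullary using (¬_)
open import Relation.Binary.PropositionalEquality using (_≡_)

IsInt : ℚ → Set
IsInt u = ∃ λ (j : ℤ) → u ≡ j ℚ./ 1

-- A model of the complex numbers restricted to the roots of unity
-- e(u) = exp(2πiu), u ∈ ℚ: a commutative ring without zero divisors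
-- together with a multiplicative character e : (ℚ,+) → R with
-- e(u) = 1 exactly when u ∈ ℤ.  (ℂ with e(u)=exp(2πiu) is such a model.)
record ExpModel (c ℓ : Level) : Set (lsuc (c ⊔ ℓ)) where
  field
    commRing : CommutativeRing c ℓ
  open CommutativeRing commRing public
  field
    noZeroDivisors : ∀ a b → a * b ≈ 0# → a ≈ 0# ⊎ b ≈ 0#
    e     : ℚ → Carrier
    e-0   : e ℚ.0ℚ ≈ 1#
    e-+   : ∀ u v → e (u ℚ.+ v) ≈ e u * e v
    e≈1⇔  : ∀ u → (e u ≈ 1# → IsInt u) × (IsInt u → e u ≈ 1#)

module _ {c ℓ : Level} (M : ExpModel c ℓ) where
  open ExpModel M

  pow : Carrier → ℕ → Carrier
  pow a zero = 1#
  pow a (suc n) = pow a n * a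

  poch : Carrier → Carrier → ℕ → Carrier
  poch a q zero = 1#
  poch a q (suc n) = poch a q n * (1# + - (a * pow q n))

data Idx : Set where
  m1 m2 m3 m4′ m4″ m5 m6 : Idx

u : Idx → ℚ → ℚ
u m1  τ = τ ℚ.* (+ 1 ℚ./ 4) ℚ.+ (+ 1 ℚ./ 2)
u m2  τ = τ ℚ.* (+ 1 ℚ./ 4)
u m3  τ = τ ℚ.* (+ 1 ℚ./ 3) ℚ.+ (+ 1 ℚ./ 2)
u m4′ τ = τ ℚ.* (+ 1 ℚ./ 12)
u m4″ τ = τ ℚ.* (+ 5 ℚ./ 12)
u m5  τ = τ ℚ.* (+ 1 ℚ./ 6) ℚ.+ (+ 1 ℚ./ 2)
u m6  τ = τ ℚ.* (+ 1 ℚ./ 3)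

-- h/k ∈ S  (with gcd(h,k)=1, k ≥ 1 assumed separately): h odd
InS : ℤ → ℕ → Set
InS h k = ¬ (+ 2 ℤD.∣ h)

InS′ : ℤ → ℕ → Set
InS′ h k = InS h k × (+ 6 ℤD.∣ (h ℤ.- + 1) ⊎ + 6 ℤD.∣ (h ℤ.+ + 1))

InSev : ℤ → ℕ → Set
InSev h k = InS h k × (2 ℕD.∣ k)

InSm : Idx → ℤ → ℕ → Set
InSm m1  h k = InS h k
InSm m2  h k = InS h k
InSm m3  h k = InS′ h k
InSm m4′ h k = InS h k
InSm m4″ h k = InS h k
InSm m5  h k = InS′ h k ⊎ InSev h k
InSm m6  h k = InS′ h k

module Submission where

-- With x = h/k and ω = e(x/2), ω^k = e(h/2) squares to 1 but is not 1 because h is odd, so in an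
-- integral domain ω^k = -1 and the factor 1 + ω^k kills (-ω;ω)_n for n ≥ k.  Every factor of the
-- denominator is 1 - e(t) with t = (±u + j x)/2, u = u^{(m1)}_x, and vanishes only if t ∈ ℤ.
-- Writing u = (α x + β)/δ gives t · 2δk = h(±α + jδ) ± kβ; the condition x ∈ S_{m1} provides a
-- prime p ∈ {2, 3} dividing δ and kβ but neither α nor h, so p does not divide this numerator,
-- whereas t ∈ ℤ would force p to divide it.

open import Defs
open import Level using (Level)
open import Data.Nat using (ℕ; suc; NonZero; _≤_; _<_)
open import Data.Integer using (ℤ; ∣_∣)
open import Data.Nat.Coprimality using (Coprime)
open import Data.Rational as ℚ using (ℚ)
open import Data.Product using (_×_)
open import Relation.Nullary using (¬_)

open import Data.Nat as ℕ using (zero; s≤s)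
import Data.Nat.Properties as ℕ
import Data.Nat.Divisibility as ℕ
open import Data.Nat.Primality using (Prime; prime[2]; prime?; euclidsLemma)
open import Data.Integer as ℤ using (+_)
import Data.Integer.Properties as ℤ
import Data.Integer.Divisibility as ℤᵘ
open import Data.Integer.Divisibility.Signed using (_∣_; divides; ∣ᵤ⇒∣; ∣⇒∣ᵤ; ∣-trans; ∣m∣n⇒∣m-n; ∣m+n∣n⇒∣m; ∣n⇒∣m*n; ∣m⇒∣m*n; ∣m⇒∣-m)
open import Data.Integer.Tactic.RingSolver using (solve-∀)
open import Data.Rational using (_/_; ½; toℚᵘ)
import Data.Rational.Properties as ℚ
import Data.Rational.Unnormalised as ℚᵘ
import Data.Rational.Unnormalised.Properties as ℚᵘ
open import Data.Rational.Solver using (module +-*-Solver)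
open +-*-Solver using (solve; con; _:+_; _:*_; :-_; _:=_)
open import Data.Product using (_,_; proj₁; proj₂)
open import Data.Sum using (_⊎_; inj₁; inj₂; [_,_]′)
open import Function using (id; _∘_)
open import Relation.Nullary.Decidable using (from-yes; from-no)
open import Relation.Nullary.Negation using (contradiction)
open import Relation.Binary.PropositionalEquality as ≡ using (_≡_; refl; sym; trans; cong; cong₂; subst; module ≡-Reasoning)

ι : ℤ → ℚ
ι a = a / 1

ι-toℚᵘ : ∀ a → toℚᵘ (ι a) ℚᵘ.≃ ℚᵘ.mkℚᵘ a 0
ι-toℚᵘ a = ℚ.toℚᵘ-fromℚᵘ (ℚᵘ.mkℚᵘ a 0)

≡ι-if-toℚᵘ≃ : ∀ r a → toℚᵘ r ℚᵘ.≃ ℚᵘ.mkℚᵘ a 0 → r ≡ ι a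
≡ι-if-toℚᵘ≃ r a r≃a = trans (sym (ℚ.fromℚᵘ-toℚᵘ r)) (ℚ.fromℚᵘ-cong r≃a)

ι-injective : ∀ {a b} → ι a ≡ ι b → a ≡ b
ι-injective {a} {b} ιa≡ιb with ℚᵘ.≃-trans (ℚᵘ.≃-sym (ι-toℚᵘ a)) (ℚᵘ.≃-trans (ℚ.toℚᵘ-cong ιa≡ιb) (ι-toℚᵘ b))
... | ℚᵘ.*≡* a*1≡b*1 = trans (sym (ℤ.*-identityʳ a)) (trans a*1≡b*1 (ℤ.*-identityʳ b))

ι-homo-+ : ∀ a b → ι (a ℤ.+ b) ≡ ι a ℚ.+ ι b
ι-homo-+ a b = sym (≡ι-if-toℚᵘ≃ (ι a ℚ.+ ι b) (a ℤ.+ b)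
  (ℚᵘ.≃-trans (ℚ.toℚᵘ-homo-+ (ι a) (ι b))
    (ℚᵘ.≃-trans (ℚᵘ.+-cong (ι-toℚᵘ a) (ι-toℚᵘ b)) (ℚᵘ.*≡* (cross-multiplied a b)))))
  where
  cross-multiplied : ∀ a b → (a ℤ.* + 1 ℤ.+ b ℤ.* + 1) ℤ.* + 1 ≡ (a ℤ.+ b) ℤ.* + 1
  cross-multiplied = solve-∀

ι-homo-* : ∀ a b → ι (a ℤ.* b) ≡ ι a ℚ.* ι b
ι-homo-* a b = sym (≡ι-if-toℚᵘ≃ (ι a ℚ.* ι b) (a ℤ.* b)
  (ℚᵘ.≃-trans (ℚ.toℚᵘ-homo-* (ι a) (ι b)) (ℚᵘ.*-cong (ι-toℚᵘ a) (ι-toℚᵘ b))))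

ι-homo-neg : ∀ a → ι (ℤ.- a) ≡ ℚ.- ι a
ι-homo-neg a = sym (≡ι-if-toℚᵘ≃ (ℚ.- ι a) (ℤ.- a)
  (ℚᵘ.≃-trans (ℚ.toℚᵘ-homo‿- (ι a)) (ℚᵘ.-‿cong (ι-toℚᵘ a))))

/-*-denominator : ∀ h k → (h / suc k) ℚ.* ι (+ suc k) ≡ ι h
/-*-denominator h k = ≡ι-if-toℚᵘ≃ _ h
  (ℚᵘ.≃-trans (ℚ.toℚᵘ-homo-* (h / suc k) (ι (+ suc k)))
    (ℚᵘ.≃-trans (ℚᵘ.*-cong (ℚ.toℚᵘ-fromℚᵘ (ℚᵘ.mkℚᵘ h k)) (ι-toℚᵘ (+ suc k)))
      (ℚᵘ.*≡* (trans (ℤ.*-identityʳ (h ℤ.* + suc k)) (cong (λ n → h ℤ.* + n) (sym (ℕ.*-identityʳ (suc k))))))))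

¬IsInt-if-∤ : ∀ {t p N M} → p ∣ N → ¬ p ∣ M → t ℚ.* ι N ≡ ι M → ¬ IsInt t
¬IsInt-if-∤ {N = N} {M} p∣N p∤M tN≡M (J , refl) =
  p∤M (subst (_ ∣_) J*N≡M (∣n⇒∣m*n J p∣N))
  where
  J*N≡M : J ℤ.* N ≡ M
  J*N≡M = ι-injective (trans (ι-homo-* J N) tN≡M)

odd/2-¬IsInt : ∀ {h} → ¬ + 2 ∣ h → ¬ IsInt (ι h ℚ.* ½)
odd/2-¬IsInt {h} 2∤h = ¬IsInt-if-∤ (divides (+ 1) refl) 2∤h (half-*-2 (ι h))
  where
  half-*-2 : ∀ A → A ℚ.* ½ ℚ.* ι (+ 2) ≡ A
  half-*-2 = solve 1 (λ A → A :* con ½ :* con (ι (+ 2)) := A) refl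

prime-∣-* : ∀ {p} m n → Prime p → + p ∣ m ℤ.* n → (+ p ∣ m) ⊎ (+ p ∣ n)
prime-∣-* m n prime-p p∣mn with euclidsLemma ∣ m ∣ ∣ n ∣ prime-p (subst (_ ℕ.∣_) (ℤ.abs-* m n) (∣⇒∣ᵤ p∣mn))
... | inj₁ p∣m = inj₁ (∣ᵤ⇒∣ p∣m)
... | inj₂ p∣n = inj₂ (∣ᵤ⇒∣ p∣n)

record PrimeObstruction (h K a b d : ℤ) : Set where
  constructor mkObstruction
  field
    p     : ℕ
    prime : Prime p
    p∣d   : + p ∣ d
    p∣Kb  : + p ∣ K ℤ.* b
    p∤a   : ¬ + p ∣ a
    p∤h   : ¬ + p ∣ h

  numerator-indivisible : ∀ j → ¬ + p ∣ h ℤ.* (a ℤ.+ j ℤ.* d) ℤ.+ K ℤ.* b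
  numerator-indivisible j p∣num with prime-∣-* h (a ℤ.+ j ℤ.* d) prime (∣m+n∣n⇒∣m p∣num p∣Kb)
  ... | inj₁ p∣h = p∤h p∣h
  ... | inj₂ p∣a+jd = p∤a (∣m+n∣n⇒∣m p∣a+jd (∣n⇒∣m*n j p∣d))

negate : ∀ {h K a b d} → PrimeObstruction h K a b d → PrimeObstruction h K (ℤ.- a) (ℤ.- b) d
negate {K = K} {a} {b} O = record
  { p = p ; prime = prime ; p∣d = p∣d
  ; p∣Kb = subst (_ ∣_) (ℤ.neg-distribʳ-* K b) (∣m⇒∣-m p∣Kb)
  ; p∤a = λ p∣-a → p∤a (subst (_ ∣_) (ℤ.neg-involutive a) (∣m⇒∣-m p∣-a))
  ; p∤h = p∤h
  }
  where open PrimeObstruction O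

exponent-scaled : ∀ {U X h K a b d} → U ℚ.* ι d ≡ X ℚ.* ι a ℚ.+ ι b → X ℚ.* ι K ≡ ι h → ∀ j →
  (U ℚ.* ½ ℚ.+ ι j ℚ.* (X ℚ.* ½)) ℚ.* ι (K ℤ.* (+ 2 ℤ.* d)) ≡ ι (h ℤ.* (a ℤ.+ j ℤ.* d) ℤ.+ K ℤ.* b)
exponent-scaled {U} {X} {h} {K} {a} {b} {d} Ud≡Xa+b XK≡h j = begin
  (U ℚ.* ½ ℚ.+ ι j ℚ.* (X ℚ.* ½)) ℚ.* ι (K ℤ.* (+ 2 ℤ.* d))
    ≡⟨ cong ((U ℚ.* ½ ℚ.+ ι j ℚ.* (X ℚ.* ½)) ℚ.*_) (trans (ι-homo-* K (+ 2 ℤ.* d)) (cong (ι K ℚ.*_) (ι-homo-* (+ 2) d))) ⟩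
  (U ℚ.* ½ ℚ.+ ι j ℚ.* (X ℚ.* ½)) ℚ.* (ι K ℚ.* (ι (+ 2) ℚ.* ι d))
    ≡⟨ expand U X (ι j) (ι K) (ι d) ⟩
  (U ℚ.* ι d) ℚ.* ι K ℚ.+ ι j ℚ.* ι d ℚ.* (X ℚ.* ι K)
    ≡⟨ cong (λ V → V ℚ.* ι K ℚ.+ ι j ℚ.* ι d ℚ.* (X ℚ.* ι K)) Ud≡Xa+b ⟩
  (X ℚ.* ι a ℚ.+ ι b) ℚ.* ι K ℚ.+ ι j ℚ.* ι d ℚ.* (X ℚ.* ι K)
    ≡⟨ regroup X (ι a) (ι b) (ι K) (ι j) (ι d) ⟩
  ι a ℚ.* (X ℚ.* ι K) ℚ.+ ι K ℚ.* ι b ℚ.+ ι j ℚ.* ι d ℚ.* (X ℚ.* ι K)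
    ≡⟨ cong (λ Y → ι a ℚ.* Y ℚ.+ ι K ℚ.* ι b ℚ.+ ι j ℚ.* ι d ℚ.* Y) XK≡h ⟩
  ι a ℚ.* ι h ℚ.+ ι K ℚ.* ι b ℚ.+ ι j ℚ.* ι d ℚ.* ι h
    ≡⟨ collect (ι a) (ι h) (ι K) (ι b) (ι j) (ι d) ⟩
  ι h ℚ.* (ι a ℚ.+ ι j ℚ.* ι d) ℚ.+ ι K ℚ.* ι b
    ≡⟨ sym (ι-numerator h a j d K b) ⟩
  ι (h ℤ.* (a ℤ.+ j ℤ.* d) ℤ.+ K ℤ.* b) ∎
  where
  open ≡-Reasoning
  expand : ∀ U X J K D → (U ℚ.* ½ ℚ.+ J ℚ.* (X ℚ.* ½)) ℚ.* (K ℚ.* (ι (+ 2) ℚ.* D))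
                         ≡ (U ℚ.* D) ℚ.* K ℚ.+ J ℚ.* D ℚ.* (X ℚ.* K)
  expand = solve 5 (λ U X J K D → (U :* con ½ :+ J :* (X :* con ½)) :* (K :* (con (ι (+ 2)) :* D))
                                  := (U :* D) :* K :+ J :* D :* (X :* K)) refl
  regroup : ∀ X A B K J D → (X ℚ.* A ℚ.+ B) ℚ.* K ℚ.+ J ℚ.* D ℚ.* (X ℚ.* K)
                            ≡ A ℚ.* (X ℚ.* K) ℚ.+ K ℚ.* B ℚ.+ J ℚ.* D ℚ.* (X ℚ.* K)
  regroup = solve 6 (λ X A B K J D → (X :* A :+ B) :* K :+ J :* D :* (X :* K)
                                     := A :* (X :* K) :+ K :* B :+ J :* D :* (X :* K)) refl
  collect : ∀ A H K B J D → A ℚ.* H ℚ.+ K ℚ.* B ℚ.+ J ℚ.* D ℚ.* H ≡ H ℚ.* (A ℚ.+ J ℚ.* D) ℚ.+ K ℚ.* B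
  collect = solve 6 (λ A H K B J D → A :* H :+ K :* B :+ J :* D :* H := H :* (A :+ J :* D) :+ K :* B) refl
  ι-numerator : ∀ h a j d K b → ι (h ℤ.* (a ℤ.+ j ℤ.* d) ℤ.+ K ℤ.* b)
                                ≡ ι h ℚ.* (ι a ℚ.+ ι j ℚ.* ι d) ℚ.+ ι K ℚ.* ι b
  ι-numerator h a j d K b = begin
    ι (h ℤ.* (a ℤ.+ j ℤ.* d) ℤ.+ K ℤ.* b)          ≡⟨ ι-homo-+ (h ℤ.* (a ℤ.+ j ℤ.* d)) (K ℤ.* b) ⟩
    ι (h ℤ.* (a ℤ.+ j ℤ.* d)) ℚ.+ ι (K ℤ.* b)      ≡⟨ cong₂ ℚ._+_ (ι-homo-* h (a ℤ.+ j ℤ.* d)) (ι-homo-* K b) ⟩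
    ι h ℚ.* ι (a ℤ.+ j ℤ.* d) ℚ.+ ι K ℚ.* ι b      ≡⟨ cong (λ V → ι h ℚ.* V ℚ.+ ι K ℚ.* ι b) (trans (ι-homo-+ a (j ℤ.* d)) (cong (ι a ℚ.+_) (ι-homo-* j d))) ⟩
    ι h ℚ.* (ι a ℚ.+ ι j ℚ.* ι d) ℚ.+ ι K ℚ.* ι b  ∎

exponent-¬IsInt : ∀ {h K a b d} → PrimeObstruction h K a b d → ∀ U X →
  U ℚ.* ι d ≡ X ℚ.* ι a ℚ.+ ι b → X ℚ.* ι K ≡ ι h → ∀ j → ¬ IsInt (U ℚ.* ½ ℚ.+ ι j ℚ.* (X ℚ.* ½))
exponent-¬IsInt {h} {K} {a} {b} {d} O U X Ud≡Xa+b XK≡h j =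
  ¬IsInt-if-∤ (∣n⇒∣m*n K (∣n⇒∣m*n (+ 2) p∣d)) (numerator-indivisible j)
    (exponent-scaled {U} {X} {h} {K} {a} {b} {d} Ud≡Xa+b XK≡h j)
  where open PrimeObstruction O

linear-neg : ∀ {U X a b d} → U ℚ.* ι d ≡ X ℚ.* ι a ℚ.+ ι b → (ℚ.- U) ℚ.* ι d ≡ X ℚ.* ι (ℤ.- a) ℚ.+ ι (ℤ.- b)
linear-neg {U} {X} {a} {b} {d} Ud≡Xa+b = begin
  (ℚ.- U) ℚ.* ι d               ≡⟨ neg-* U (ι d) ⟩
  ℚ.- (U ℚ.* ι d)               ≡⟨ cong ℚ.-_ Ud≡Xa+b ⟩
  ℚ.- (X ℚ.* ι a ℚ.+ ι b)       ≡⟨ neg-+ X (ι a) (ι b) ⟩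
  X ℚ.* ℚ.- ι a ℚ.+ ℚ.- ι b     ≡⟨ sym (cong₂ (λ A B → X ℚ.* A ℚ.+ B) (ι-homo-neg a) (ι-homo-neg b)) ⟩
  X ℚ.* ι (ℤ.- a) ℚ.+ ι (ℤ.- b) ∎
  where
  open ≡-Reasoning
  neg-* : ∀ U D → (ℚ.- U) ℚ.* D ≡ ℚ.- (U ℚ.* D)
  neg-* = solve 2 (λ U D → (:- U) :* D := :- (U :* D)) refl
  neg-+ : ∀ X A B → ℚ.- (X ℚ.* A ℚ.+ B) ≡ X ℚ.* ℚ.- A ℚ.+ ℚ.- B
  neg-+ = solve 3 (λ X A B → :- (X :* A :+ B) := X :* (:- A) :+ (:- B)) refl

exponent-shift : ∀ U X j → ℚ.- (U ℚ.* ½) ℚ.+ X ℚ.* ½ ℚ.+ ι (+ j) ℚ.* (X ℚ.* ½)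
                           ≡ (ℚ.- U) ℚ.* ½ ℚ.+ ι (+ suc j) ℚ.* (X ℚ.* ½)
exponent-shift U X j = trans (shift U X (ι (+ j))) (cong (λ J → (ℚ.- U) ℚ.* ½ ℚ.+ J ℚ.* (X ℚ.* ½)) (sym (ι-homo-+ (+ 1) (+ j))))
  where
  shift : ∀ U X J → ℚ.- (U ℚ.* ½) ℚ.+ X ℚ.* ½ ℚ.+ J ℚ.* (X ℚ.* ½) ≡ (ℚ.- U) ℚ.* ½ ℚ.+ (ι (+ 1) ℚ.+ J) ℚ.* (X ℚ.* ½)
  shift = solve 3 (λ U X J → :- (U :* con ½) :+ X :* con ½ :+ J :* (X :* con ½)
                             := (:- U) :* con ½ :+ (con (ι (+ 1)) :+ J) :* (X :* con ½)) refl

uα uβ uδ : Idx → ℤ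
uα m1  = + 1
uα m2  = + 1
uα m3  = + 2
uα m4′ = + 1
uα m4″ = + 5
uα m5  = + 1
uα m6  = + 1
uβ m1  = + 2
uβ m2  = + 0
uβ m3  = + 3
uβ m4′ = + 0
uβ m4″ = + 0
uβ m5  = + 3
uβ m6  = + 0
uδ m1  = + 4
uδ m2  = + 4
uδ m3  = + 6
uδ m4′ = + 12
uδ m4″ = + 12
uδ m5  = + 6
uδ m6  = + 3

u-linear : ∀ m X → u m X ℚ.* ι (uδ m) ≡ X ℚ.* ι (uα m) ℚ.+ ι (uβ m)
u-linear m1  = solve 1 (λ X → (X :* con (+ 1 / 4) :+ con (+ 1 / 2)) :* con (ι (+ 4)) := X :* con (ι (+ 1)) :+ con (ι (+ 2))) refl
u-linear m2  = solve 1 (λ X → (X :* con (+ 1 / 4)) :* con (ι (+ 4)) := X :* con (ι (+ 1)) :+ con (ι (+ 0))) refl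
u-linear m3  = solve 1 (λ X → (X :* con (+ 1 / 3) :+ con (+ 1 / 2)) :* con (ι (+ 6)) := X :* con (ι (+ 2)) :+ con (ι (+ 3))) refl
u-linear m4′ = solve 1 (λ X → (X :* con (+ 1 / 12)) :* con (ι (+ 12)) := X :* con (ι (+ 1)) :+ con (ι (+ 0))) refl
u-linear m4″ = solve 1 (λ X → (X :* con (+ 5 / 12)) :* con (ι (+ 12)) := X :* con (ι (+ 5)) :+ con (ι (+ 0))) refl
u-linear m5  = solve 1 (λ X → (X :* con (+ 1 / 6) :+ con (+ 1 / 2)) :* con (ι (+ 6)) := X :* con (ι (+ 1)) :+ con (ι (+ 3))) refl
u-linear m6  = solve 1 (λ X → (X :* con (+ 1 / 3)) :* con (ι (+ 3)) := X :* con (ι (+ 1)) :+ con (ι (+ 0))) refl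

2∤1 : ¬ + 2 ∣ + 1
2∤1 2∣1 = from-no (2 ℕ.∣? 1) (∣⇒∣ᵤ 2∣1)

2∤5 : ¬ + 2 ∣ + 5
2∤5 2∣5 = from-no (2 ℕ.∣? 5) (∣⇒∣ᵤ 2∣5)

3∤1 : ¬ + 3 ∣ + 1
3∤1 3∣1 = from-no (3 ℕ.∣? 1) (∣⇒∣ᵤ 3∣1)

3∤2 : ¬ + 3 ∣ + 2
3∤2 3∣2 = from-no (3 ℕ.∣? 2) (∣⇒∣ᵤ 3∣2)

prime[3] : Prime 3
prime[3] = from-yes (prime? 3)

odd⇒2∤ : ∀ {h} → ¬ (+ 2 ℤᵘ.∣ h) → ¬ + 2 ∣ h
odd⇒2∤ odd 2∣h = odd (∣⇒∣ᵤ 2∣h)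

±1-mod-6⇒3∤ : ∀ {h} → + 6 ℤᵘ.∣ (h ℤ.- + 1) ⊎ + 6 ℤᵘ.∣ (h ℤ.+ + 1) → ¬ + 3 ∣ h
±1-mod-6⇒3∤ {h} (inj₁ 6∣h-1) 3∣h =
  3∤1 (subst (+ 3 ∣_) (h-[h-1]≡1 h) (∣m∣n⇒∣m-n 3∣h (∣-trans (divides (+ 2) refl) (∣ᵤ⇒∣ 6∣h-1))))
  where
  h-[h-1]≡1 : ∀ h → h ℤ.- (h ℤ.- + 1) ≡ + 1
  h-[h-1]≡1 = solve-∀
±1-mod-6⇒3∤ {h} (inj₂ 6∣h+1) 3∣h =
  3∤1 (subst (+ 3 ∣_) ([h+1]-h≡1 h) (∣m∣n⇒∣m-n {m = h ℤ.+ + 1} (∣-trans (divides (+ 2) refl) (∣ᵤ⇒∣ 6∣h+1)) 3∣h))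
  where
  [h+1]-h≡1 : ∀ h → (h ℤ.+ + 1) ℤ.- h ≡ + 1
  [h+1]-h≡1 = solve-∀

obstruction : ∀ m h k → InSm m h k → PrimeObstruction h (+ k) (uα m) (uβ m) (uδ m)
obstruction m1  h k h/k∈S = mkObstruction 2 prime[2] (divides (+ 2) refl) (∣n⇒∣m*n (+ k) (divides (+ 1) refl)) 2∤1 (odd⇒2∤ h/k∈S)
obstruction m2  h k h/k∈S = mkObstruction 2 prime[2] (divides (+ 2) refl) (∣n⇒∣m*n (+ k) (divides (+ 0) refl)) 2∤1 (odd⇒2∤ h/k∈S)
obstruction m3  h k h/k∈S′ = mkObstruction 3 prime[3] (divides (+ 2) refl) (∣n⇒∣m*n (+ k) (divides (+ 1) refl)) 3∤2 (±1-mod-6⇒3∤ (proj₂ h/k∈S′))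
obstruction m4′ h k h/k∈S = mkObstruction 2 prime[2] (divides (+ 6) refl) (∣n⇒∣m*n (+ k) (divides (+ 0) refl)) 2∤1 (odd⇒2∤ h/k∈S)
obstruction m4″ h k h/k∈S = mkObstruction 2 prime[2] (divides (+ 6) refl) (∣n⇒∣m*n (+ k) (divides (+ 0) refl)) 2∤5 (odd⇒2∤ h/k∈S)
obstruction m5  h k (inj₁ h/k∈S′) = mkObstruction 3 prime[3] (divides (+ 2) refl) (∣n⇒∣m*n (+ k) (divides (+ 1) refl)) 3∤1 (±1-mod-6⇒3∤ (proj₂ h/k∈S′))
obstruction m5  h k (inj₂ (odd , 2∣k)) = mkObstruction 2 prime[2] (divides (+ 3) refl) (∣m⇒∣m*n (+ 3) (∣ᵤ⇒∣ {+ 2} {+ k} 2∣k)) 2∤1 (odd⇒2∤ odd)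
obstruction m6  h k h/k∈S′ = mkObstruction 3 prime[3] (divides (+ 1) refl) (∣n⇒∣m*n (+ k) (divides (+ 0) refl)) 3∤1 (±1-mod-6⇒3∤ (proj₂ h/k∈S′))

InSm⇒InS : ∀ m {h k} → InSm m h k → InS h k
InSm⇒InS m1  h/k∈S = h/k∈S
InSm⇒InS m2  h/k∈S = h/k∈S
InSm⇒InS m3  h/k∈S′ = proj₁ h/k∈S′
InSm⇒InS m4′ h/k∈S = h/k∈S
InSm⇒InS m4″ h/k∈S = h/k∈S
InSm⇒InS m5  (inj₁ h/k∈S′) = proj₁ h/k∈S′
InSm⇒InS m5  (inj₂ h/k∈Sev) = proj₁ h/k∈Sev
InSm⇒InS m6  h/k∈S′ = proj₁ h/k∈S′

module _ {c ℓ : Level} (M : ExpModel c ℓ) where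
  open ExpModel M renaming (refl to ≈-refl; sym to ≈-sym; trans to ≈-trans; reflexive to ≈-reflexive)
  open import Algebra.Properties.Ring ring using (-‿distribˡ-*; -‿distribʳ-*; -‿involutive; x∙y⁻¹≈ε⇒x≈y)
  open import Relation.Binary.Reasoning.Setoid setoid

  e-cong : ∀ {s t} → s ≡ t → e s ≈ e t
  e-cong s≡t = ≈-reflexive (cong e s≡t)

  1≉0 : ¬ 1# ≈ 0#
  -- ι (+ 1) ℚ.* ½ reduces to ½, so odd/2-¬IsInt 2∤1 says that ½ ∉ ℤ.
  1≉0 1≈0 = odd/2-¬IsInt 2∤1 (proj₁ (e≈1⇔ ½) e½≈1)
    where
    e½≈1 : e ½ ≈ 1#
    e½≈1 = begin
      e ½       ≈⟨ ≈-sym (*-identityʳ (e ½)) ⟩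
      e ½ * 1#  ≈⟨ *-congˡ 1≈0 ⟩
      e ½ * 0#  ≈⟨ zeroʳ (e ½) ⟩
      0#        ≈⟨ ≈-sym 1≈0 ⟩
      1#        ∎

  *-≉0 : ∀ {a b} → ¬ a ≈ 0# → ¬ b ≈ 0# → ¬ a * b ≈ 0#
  *-≉0 a≉0 b≉0 ab≈0 = [ a≉0 , b≉0 ]′ (noZeroDivisors _ _ ab≈0)

  y*y≈1∧y≉1⇒1+y≈0 : ∀ {y} → y * y ≈ 1# → ¬ y ≈ 1# → 1# + y ≈ 0#
  y*y≈1∧y≉1⇒1+y≈0 {y} y*y≈1 y≉1 =
    [ id , (λ y-1≈0 → contradiction (x∙y⁻¹≈ε⇒x≈y y 1# y-1≈0) y≉1) ]′
      (noZeroDivisors (1# + y) (y + - 1#) product≈0)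
    where
    product≈0 : (1# + y) * (y + - 1#) ≈ 0#
    product≈0 = begin
      (1# + y) * (y + - 1#)            ≈⟨ distribˡ (1# + y) y (- 1#) ⟩
      (1# + y) * y + (1# + y) * - 1#   ≈⟨ +-cong (distribʳ y 1# y) (≈-sym (-‿distribʳ-* (1# + y) 1#)) ⟩
      (1# * y + y * y) + - ((1# + y) * 1#) ≈⟨ +-cong (+-cong (*-identityˡ y) y*y≈1) (-‿cong (*-identityʳ (1# + y))) ⟩
      (y + 1#) + - (1# + y)            ≈⟨ +-congʳ (+-comm y 1#) ⟩
      (1# + y) + - (1# + y)            ≈⟨ -‿inverseʳ (1# + y) ⟩
      0#                               ∎

  1+e[odd/2]≈0 : ∀ {h} → ¬ + 2 ∣ h → 1# + e (ι h ℚ.* ½) ≈ 0#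
  1+e[odd/2]≈0 {h} 2∤h = y*y≈1∧y≉1⇒1+y≈0 square≈1 (λ y≈1 → odd/2-¬IsInt 2∤h (proj₁ (e≈1⇔ _) y≈1))
    where
    half+half : ∀ A → A ℚ.* ½ ℚ.+ A ℚ.* ½ ≡ A
    half+half = solve 1 (λ A → A :* con ½ :+ A :* con ½ := A) refl
    square≈1 : e (ι h ℚ.* ½) * e (ι h ℚ.* ½) ≈ 1#
    square≈1 = begin
      e (ι h ℚ.* ½) * e (ι h ℚ.* ½)   ≈⟨ ≈-sym (e-+ (ι h ℚ.* ½) (ι h ℚ.* ½)) ⟩
      e (ι h ℚ.* ½ ℚ.+ ι h ℚ.* ½)     ≈⟨ e-cong (half+half (ι h)) ⟩
      e (ι h)                         ≈⟨ proj₂ (e≈1⇔ (ι h)) (h , refl) ⟩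
      1#                              ∎

  pow-e : ∀ w n → pow M (e w) n ≈ e (ι (+ n) ℚ.* w)
  pow-e w zero = ≈-sym (≈-trans (e-cong (zero-* w)) e-0)
    where
    zero-* : ∀ W → ι (+ 0) ℚ.* W ≡ ℚ.0ℚ
    zero-* = solve 1 (λ W → con (ι (+ 0)) :* W := con ℚ.0ℚ) refl
  pow-e w (suc n) = begin
    pow M (e w) n * e w               ≈⟨ *-congʳ (pow-e w n) ⟩
    e (ι (+ n) ℚ.* w) * e w           ≈⟨ ≈-sym (e-+ (ι (+ n) ℚ.* w) w) ⟩
    e (ι (+ n) ℚ.* w ℚ.+ w)           ≈⟨ e-cong (succ-* (ι (+ n)) w) ⟩
    e ((ι (+ 1) ℚ.+ ι (+ n)) ℚ.* w)   ≈⟨ e-cong (cong (ℚ._* w) (≡.sym (ι-homo-+ (+ 1) (+ n)))) ⟩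
    e (ι (+ suc n) ℚ.* w)             ∎
    where
    succ-* : ∀ N W → N ℚ.* W ℚ.+ W ≡ (ι (+ 1) ℚ.+ N) ℚ.* W
    succ-* = solve 2 (λ N W → N :* W :+ W := (con (ι (+ 1)) :+ N) :* W) refl

  poch-≉0 : ∀ {a s w} → a ≈ e s → (∀ j → ¬ IsInt (s ℚ.+ ι (+ j) ℚ.* w)) → ∀ n → ¬ poch M a (e w) n ≈ 0#
  poch-≉0 a≈es ¬int zero = 1≉0
  poch-≉0 {a} {s} {w} a≈es ¬int (suc n) = *-≉0 (poch-≉0 a≈es ¬int n) factor≉0
    where
    factor≉0 : ¬ 1# + - (a * pow M (e w) n) ≈ 0#
    factor≉0 factor≈0 = ¬int n (proj₁ (e≈1⇔ (s ℚ.+ ι (+ n) ℚ.* w)) (begin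
      e (s ℚ.+ ι (+ n) ℚ.* w)      ≈⟨ e-+ s (ι (+ n) ℚ.* w) ⟩
      e s * e (ι (+ n) ℚ.* w)      ≈⟨ *-cong (≈-sym a≈es) (≈-sym (pow-e w n)) ⟩
      a * pow M (e w) n            ≈⟨ ≈-sym (x∙y⁻¹≈ε⇒x≈y 1# _ factor≈0) ⟩
      1#                           ∎))

  poch-≈0 : ∀ {a q j} → 1# + - (a * pow M q j) ≈ 0# → ∀ n → j < n → poch M a q n ≈ 0#
  poch-≈0 {a} {q} {j} factor≈0 (suc n) (s≤s j≤n) with ℕ.m≤n⇒m<n∨m≡n j≤n
  ... | inj₁ j<n  = ≈-trans (*-congʳ (poch-≈0 factor≈0 n j<n)) (zeroˡ _)
  ... | inj₂ refl = ≈-trans (*-congˡ factor≈0) (zeroʳ _)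

  poch-neg-≈0 : ∀ {w h} k → ι (+ suc k) ℚ.* w ≡ ι h ℚ.* ½ → ¬ + 2 ∣ h →
                ∀ n → suc k ≤ n → poch M (- e w) (e w) n ≈ 0#
  poch-neg-≈0 {w} {h} k kw≡h/2 2∤h = poch-≈0 {j = k} (begin
    1# + - (- e w * pow M (e w) k)    ≈⟨ +-congˡ (-‿cong (≈-sym (-‿distribˡ-* (e w) (pow M (e w) k)))) ⟩
    1# + - - (e w * pow M (e w) k)    ≈⟨ +-congˡ (-‿involutive _) ⟩
    1# + e w * pow M (e w) k          ≈⟨ +-congˡ (*-comm (e w) _) ⟩
    1# + pow M (e w) (suc k)          ≈⟨ +-congˡ (pow-e w (suc k)) ⟩
    1# + e (ι (+ suc k) ℚ.* w)        ≈⟨ +-congˡ (e-cong kw≡h/2) ⟩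
    1# + e (ι h ℚ.* ½)                ≈⟨ 1+e[odd/2]≈0 2∤h ⟩
    0#                                ∎)

lemma4p3 : {c ℓ : Level} (M : ExpModel c ℓ) (m : Idx) (h : ℤ) (k : ℕ) .{{_ : NonZero k}} →
    Coprime ∣ h ∣ k → InSm m h k →
    let open ExpModel M
        x = h ℚ./ k
        ω = e (x ℚ.* ℚ.½)
        z = e (u m x ℚ.* ℚ.½)
        z⁻¹ = e (ℚ.- (u m x ℚ.* ℚ.½))
    in ((n : ℕ) → k ≤ n → poch M (- ω) ω n ≈ 0#)
       × ((n : ℕ) → n < k →
            ¬ (poch M z ω (suc n) * poch M (z⁻¹ * ω) ω (suc n) ≈ 0#))
lemma4p3 M m h (suc k) _ h/k∈S =
  poch-neg-≈0 M {h = h} k kx/2≡h/2 (odd⇒2∤ (InSm⇒InS m h/k∈S)) ,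
  λ n _ → *-≉0 M (poch-≉0 M R.refl ¬IsInt₁ (suc n))
                 (poch-≉0 M (R.sym (R.e-+ (ℚ.- (U ℚ.* ½)) (x ℚ.* ½))) ¬IsInt₂ (suc n))
  where
  module R = ExpModel M
  x U : ℚ
  x = h / suc k
  U = u m x
  xk≡h : x ℚ.* ι (+ suc k) ≡ ι h
  xk≡h = /-*-denominator h k
  u-lin : U ℚ.* ι (uδ m) ≡ x ℚ.* ι (uα m) ℚ.+ ι (uβ m)
  u-lin = u-linear m x
  O : PrimeObstruction h (+ suc k) (uα m) (uβ m) (uδ m)
  O = obstruction m h (suc k) h/k∈S
  kx/2≡h/2 : ι (+ suc k) ℚ.* (x ℚ.* ½) ≡ ι h ℚ.* ½
  kx/2≡h/2 = trans (swap (ι (+ suc k)) x) (cong (ℚ._* ½) xk≡h)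
    where
    swap : ∀ K X → K ℚ.* (X ℚ.* ½) ≡ (X ℚ.* K) ℚ.* ½
    swap = solve 2 (λ K X → K :* (X :* con ½) := (X :* K) :* con ½) refl
  ¬IsInt₁ : ∀ j → ¬ IsInt (U ℚ.* ½ ℚ.+ ι (+ j) ℚ.* (x ℚ.* ½))
  ¬IsInt₁ j = exponent-¬IsInt O U x u-lin xk≡h (+ j)
  ¬IsInt₂ : ∀ j → ¬ IsInt (ℚ.- (U ℚ.* ½) ℚ.+ x ℚ.* ½ ℚ.+ ι (+ j) ℚ.* (x ℚ.* ½))
  ¬IsInt₂ j = subst (¬_ ∘ IsInt) (sym (exponent-shift U x j))
    (exponent-¬IsInt (negate O) (ℚ.- U) x (linear-neg {U} {x} {uα m} {uβ m} {uδ m} u-lin) xk≡h (+ suc j))
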